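{- Let $\mathcal{F}$ be a product-bounded family of functions from $\mathbb{N}$ to $\mathbb{N}_0$ and let $g:\mathbb{N}\to\mathbb{N}_0$. Suppose that for every ideal $X$ in $(\mathcal{C}(D_2),\preceq)$ either there is $f\in\mathcal{F}$ with $|X_n|\le f(n)$ for all $n\ge1$, or $|X_n|\ge g(n)$ for all $n\ge 1$. Then for every finite poset $P$ and every ideal $X$ in $(\mathcal{C}(P),\preceq)$, either there is $f\in\mathcal{F}$ with $|X_n|\le f(n)$ for all $n\ge1$, or $|X_n|\ge g(n)$ for all $n\ge1$.
   Context: For a finite poset $Q=(Q,\le_Q)$, $\mathcal{C}(Q)$ is the set of pairs $(n,\chi)$ with $n\in\mathbb{N}_0$ and $\chi:\binom{[n]}{2}\to Q$, and $(m,\psi)\preceq(n,\chi)$ iff there is an increasing $f:[m]\to[n]$ with $\psi(\{i,j\})\le_Q\chi(\{f(i),f(j)\})$ for all $i<j$. An ideal is a down-closed subset; $X_n=\{(n,\chi)\in X\}$. $D_2=([2],=)$ is the two-element discrete poset. A family $\mathcal{F}$ of functions $\mathbb{N}\to\mathbb{N}_0$ is product-bounded if for any finitely many $f_1,\dots,f_k\in\mathcal{F}$ there is $f\in\mathcal{F}$ with $f_1(n)f_2(n)\cdots f_k(n)\le f(n)$ for all $n\ge1$. -}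

module Defs where

open import Level using (0ℓ)
open import Data.Nat using (ℕ; _≤_; _*_)
open import Data.Fin using (Fin) renaming (_<_ to _<ᶠ_)
open import Data.List using (List; []; _∷_; length; foldr; map)
open import Data.List.Relation.Unary.All using (All)
open import Data.List.Relation.Unary.AllPairs using (AllPairs)
open import Data.Product using (Σ; ∃; _×_; _,_)
open import Relation.Binary using (Rel; IsPartialOrder)
open import Relation.Binary.PropositionalEquality using (_≡_)
open import Relation.Nullary using (¬_)

-- A finite poset is (up to isomorphism) a partial order on Fin k.
record FinPoset : Set₁ where
  field
    size  : ℕ
    _≤P_  : Rel (Fin size) 0ℓ
    isPO  : IsPartialOrder _≡_ _≤P_

open FinPoset public

D₂ : FinPoset
D₂ = record { size = 2 ; _≤P_ = _≡_ ; isPO = isPO≡ }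
  where
  open import Relation.Binary.PropositionalEquality.Properties using (isPreorder)
  open import Relation.Binary.PropositionalEquality using (refl)
  isPO≡ : IsPartialOrder {A = Fin 2} _≡_ _≡_
  isPO≡ = record { isPreorder = isPreorder ; antisym = λ p _ → p }

-- A colouring χ : ([n] choose 2) → P is represented by a function of two
-- arguments, of which only the values χ i j with i < j are meaningful.
Colouring : FinPoset → ℕ → Set
Colouring P n = Fin n → Fin n → Fin (size P)

SameCol : (P : FinPoset) {n : ℕ} → Colouring P n → Colouring P n → Set
SameCol P {n} χ ψ = (i j : Fin n) → i <ᶠ j → χ i j ≡ ψ i j

𝒞 : FinPoset → Set
𝒞 P = Σ ℕ (Colouring P)

Emb : (P : FinPoset) → 𝒞 P → 𝒞 P → Set
Emb P (m , ψ) (n , χ) =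
  Σ (Fin m → Fin n) λ f →
    ((i j : Fin m) → i <ᶠ j → f i <ᶠ f j) ×
    ((i j : Fin m) → i <ᶠ j → _≤P_ P (ψ i j) (χ (f i) (f j)))

IsIdeal : (P : FinPoset) → (𝒞 P → Set) → Set
IsIdeal P X = ∀ a b → Emb P a b → X b → X a

DistinctIn : (P : FinPoset) → (𝒞 P → Set) → (n : ℕ) → List (Colouring P n) → Set
DistinctIn P X n xs =
  All (λ χ → X (n , χ)) xs × AllPairs (λ χ ψ → ¬ SameCol P χ ψ) xs

CardLe : (P : FinPoset) → (𝒞 P → Set) → ℕ → ℕ → Set
CardLe P X n m = ∀ xs → DistinctIn P X n xs → length xs ≤ m

CardGe : (P : FinPoset) → (𝒞 P → Set) → ℕ → ℕ → Set
CardGe P X n m = Σ (List (Colouring P n)) λ xs → DistinctIn P X n xs × m ≤ length xs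

-- Families of functions ℕ → ℕ₀ (values at 0 are irrelevant: only n ≥ 1 is used).
Family : Set₁
Family = (ℕ → ℕ) → Set

prodAt : List (ℕ → ℕ) → ℕ → ℕ
prodAt fs n = foldr (λ f r → f n * r) 1 fs

ProductBounded : Family → Set
ProductBounded 𝓕 =
  ∀ (f₁ : ℕ → ℕ) (fs : List (ℕ → ℕ)) → 𝓕 f₁ → All 𝓕 fs →
  Σ (ℕ → ℕ) λ f → 𝓕 f × (∀ n → 1 ≤ n → prodAt (f₁ ∷ fs) n ≤ f n)

Dichotomy : Family → (ℕ → ℕ) → (P : FinPoset) → (𝒞 P → Set) → Set
Dichotomy 𝓕 g P X =
  (Σ (ℕ → ℕ) λ f → 𝓕 f × (∀ n → 1 ≤ n → CardLe P X n (f n)))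
  ⊎' (∀ n → 1 ≤ n → CardGe P X n (g n))
  where open import Data.Sum using () renaming (_⊎_ to _⊎'_)

{-# OPTIONS --safe #-}
-- For a colour q of P, the colour class of χ ∈ 𝒞(P) is the D₂-colouring that marks the
-- pairs χ colours q; the classes of the members of an ideal X of 𝒞(P) form an ideal X_q of
-- 𝒞(D₂). A colouring is determined by its colour classes, so |X_n| ≤ ∏_q |(X_q)_n|, while
-- |X_n| ≥ |(X_q)_n| for each q. Hence if some X_q is large then so is X, and if every X_q is
-- bounded by a member of 𝓕 then X is bounded by their product, which product-boundedness
-- dominates by a member of 𝓕.

module Submission where

open import Defs
open import Level using (0ℓ)
open import Data.Bool using (if_then_else_)
open import Data.Empty using (⊥)
open import Data.Nat using (ℕ; zero; suc; _≤_; _*_; _+_; z≤n; s≤s; s≤s⁻¹)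
open import Data.Nat.Properties using (≤-trans; ≤-reflexive; +-mono-≤; +-suc; module ≤-Reasoning)
open import Data.Fin using (Fin; zero; suc)
open import Data.Fin.Properties using (all?; _≟_; _<?_; ∀-cons)
open import Data.List using (List; []; _∷_; length; filter; map; allFin; tabulate)
open import Data.Nat.ListAction using (product)
open import Data.List.Properties using (length-map)
open import Data.List.Relation.Unary.All as All using (All; []; _∷_)
import Data.List.Relation.Unary.All.Properties as All
open import Data.List.Relation.Unary.AllPairs as AllPairs using (AllPairs; []; _∷_)
import Data.List.Relation.Unary.AllPairs.Properties as AllPairs
open import Data.List.Relation.Binary.Pointwise using (Pointwise; []; _∷_; Pointwise-length)
open import Data.List.Membership.Propositional.Properties using (∈-allFin)
open import Data.Product using (Σ; ∃; _×_; _,_; proj₁; proj₂)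
open import Data.Sum using (_⊎_; inj₁; inj₂)
open import Function using (_on_; _∘_)
open import Relation.Nullary using (¬_; Dec; yes; no; does; contradiction)
open import Relation.Nullary.Decidable using (_→-dec_)
open import Relation.Unary using (Pred; Decidable)
open import Relation.Unary.Properties using (∁?)
open import Relation.Binary using (Rel; _⇒_; IsEquivalence; IsDecEquivalence; IsPartialOrder)
open import Relation.Binary.Construct.Intersection using (_∩_)
import Relation.Binary.Construct.On as On
open import Relation.Binary.PropositionalEquality using (_≡_; refl; sym; trans; cong)

module _ {A : Set} where

  Distinct : Rel A 0ℓ → Pred (List A) 0ℓ
  Distinct R = AllPairs (λ x y → ¬ R x y)

  AtMost : Pred A 0ℓ → Rel A 0ℓ → ℕ → Set
  AtMost U R b = ∀ xs → All U xs × Distinct R xs → length xs ≤ b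

  AtLeast : Pred A 0ℓ → Rel A 0ℓ → ℕ → Set
  AtLeast U R m = Σ (List A) λ xs → (All U xs × Distinct R xs) × m ≤ length xs

  length-filter-∁ : {P : Pred A 0ℓ} (P? : Decidable P) (xs : List A) →
                    length xs ≡ length (filter P? xs) + length (filter (∁? P?) xs)
  length-filter-∁ P? [] = refl
  length-filter-∁ P? (x ∷ xs) with P? x
  ... | yes _ = cong suc (length-filter-∁ P? xs)
  ... | no _  = trans (cong suc (length-filter-∁ P? xs)) (sym (+-suc _ _))

  AtMost-≤ : ∀ {U R b c} → b ≤ c → AtMost U R b → AtMost U R c
  AtMost-≤ b≤c bound xs distinct = ≤-trans (bound xs distinct) b≤c

  AtMost-resp-⇒ : ∀ {U R S b} → R ⇒ S → AtMost U R b → AtMost U S b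
  AtMost-resp-⇒ R⇒S bound xs (us , ds) = bound xs (us , AllPairs.map (λ ¬s r → ¬s (R⇒S r)) ds)

  AtMost-total : ∀ {U R} → (∀ x y → R x y) → AtMost U R 1
  AtMost-total R-total []           _                 = z≤n
  AtMost-total R-total (_ ∷ [])     _                 = s≤s z≤n
  AtMost-total R-total (x ∷ y ∷ _)  (_ , (¬r ∷ _) ∷ _) = contradiction (R-total x y) ¬r

  module _ {R S : Rel A 0ℓ} (R-isDecEquivalence : IsDecEquivalence R) where
    open IsDecEquivalence R-isDecEquivalence
      renaming (_≟_ to _≟ᴿ_; sym to R-sym; trans to R-trans)

    Distinct-∩-within-class : ∀ {y xs} → All (R y) xs → Distinct (R ∩ S) xs → Distinct S xs
    Distinct-∩-within-class []       []       = []
    Distinct-∩-within-class (r ∷ rs) (d ∷ ds) =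
      All.zipWith (λ (r′ , ¬rs) s → ¬rs (R-trans (R-sym r) r′ , s)) (rs , d)
      ∷ Distinct-∩-within-class rs ds

    -- Split off the R-class of the first element; the rest has one R-class fewer.
    AtMost-∩ : ∀ {U b c} → AtMost U R b → AtMost U S c → AtMost U (R ∩ S) (b * c)
    AtMost-∩ _ _ [] _ = z≤n
    AtMost-∩ {b = zero} R-bound _ (y ∷ _) (u ∷ _ , _) =
      contradiction (R-bound (y ∷ []) (u ∷ [] , [] ∷ [])) λ ()
    AtMost-∩ {U} {suc b} {c} R-bound S-bound (y ∷ ys) (us , ds) = begin
      length (y ∷ ys)              ≡⟨ length-filter-∁ (y ≟ᴿ_) (y ∷ ys) ⟩
      length class + length rest   ≤⟨ +-mono-≤ class-bound rest-bound ⟩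
      c + b * c                    ∎
      where
      open ≤-Reasoning
      class rest : List A
      class = filter (y ≟ᴿ_) (y ∷ ys)
      rest  = filter (∁? (y ≟ᴿ_)) (y ∷ ys)

      class-bound : length class ≤ c
      class-bound = S-bound class
        ( All.filter⁺ (y ≟ᴿ_) us
        , Distinct-∩-within-class (All.all-filter (y ≟ᴿ_) (y ∷ ys)) (AllPairs.filter⁺ (y ≟ᴿ_) ds))

      R-bound-off-y : AtMost (λ x → U x × ¬ R y x) R b
      R-bound-off-y xs (us′ , ds′) =
        s≤s⁻¹ (R-bound (y ∷ xs) (All.head us ∷ All.map proj₁ us′ , All.map proj₂ us′ ∷ ds′))

      rest-bound : length rest ≤ b * c
      rest-bound = AtMost-∩ R-bound-off-y
        (λ xs (us′ , ds′) → S-bound xs (All.map proj₁ us′ , ds′)) rest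
        ( All.zip (All.filter⁺ (∁? (y ≟ᴿ_)) us , All.all-filter (∁? (y ≟ᴿ_)) (y ∷ ys))
        , AllPairs.filter⁺ (∁? (y ≟ᴿ_)) ds)

  AtMost-⋂ : ∀ {I : Set} {R : I → Rel A 0ℓ} {U} {b : I → ℕ} →
             (∀ i → IsDecEquivalence (R i)) → (∀ i → AtMost U (R i) (b i)) →
             ∀ is → AtMost U (λ x y → All (λ i → R i x y) is) (product (map b is))
  AtMost-⋂ _ _ [] = AtMost-total (λ _ _ → [])
  AtMost-⋂ isDecEq bound (i ∷ is) =
    AtMost-resp-⇒ (λ (r , rs) → r ∷ rs) (AtMost-∩ (isDecEq i) (bound i) (AtMost-⋂ isDecEq bound is))

AtLeast-of-empty : ∀ {A B : Set} {R : Rel A 0ℓ} {U : Pred B 0ℓ} {S m} →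
                   AtLeast (λ _ → ⊥) R m → AtLeast U S m
AtLeast-of-empty ([] , _ , m≤0)            = [] , ([] , []) , m≤0
AtLeast-of-empty (_ ∷ _ , (() ∷ _ , _) , _)

AtMost-kernel : ∀ {A B : Set} (π : A → B) {U : Pred A 0ℓ} {V : Pred B 0ℓ} {S b} →
                (∀ {x} → U x → V (π x)) → AtMost V S b → AtMost U (S on π) b
AtMost-kernel π U⇒V bound xs (us , ds) =
  ≤-trans (≤-reflexive (sym (length-map π xs)))
          (bound (map π xs) (All.map⁺ (All.map U⇒V us) , AllPairs.map⁺ ds))

Image : {A B : Set} → Pred A 0ℓ → (A → B) → Rel B 0ℓ → Pred B 0ℓ
Image U π S z = ∃ λ x → U x × S (π x) z

module _ {A B : Set} (π : A → B) {R : Rel A 0ℓ} {S : Rel B 0ℓ}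
         (S-isEquivalence : IsEquivalence S) (π-resp : R ⇒ (S on π)) {U : Pred A 0ℓ} where
  open IsEquivalence S-isEquivalence renaming (sym to S-sym; trans to S-trans)

  private
    Over : List A → List B → Set
    Over = Pointwise (λ x z → S (π x) z)

    distinct-head : ∀ {x z xs zs} → S (π x) z → All (λ z′ → ¬ S z z′) zs → Over xs zs →
                    All (λ x′ → ¬ R x x′) xs
    distinct-head s [] [] = []
    distinct-head s (¬s ∷ ¬ss) (s′ ∷ ss) =
      (λ r → ¬s (S-trans (S-trans (S-sym s) (π-resp r)) s′)) ∷ distinct-head s ¬ss ss

    preimages : ∀ {zs} → All (Image U π S) zs → Distinct S zs →
                ∃ λ xs → (All U xs × Distinct R xs) × Over xs zs
    preimages [] [] = [] , ([] , []) , []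
    preimages ((x , u , s) ∷ ws) (¬s ∷ ds) with preimages ws ds
    ... | xs , (us , rs) , ss = x ∷ xs , (u ∷ us , distinct-head s ¬s ss ∷ rs) , s ∷ ss

  AtLeast-preimage : ∀ {m} → AtLeast (Image U π S) S m → AtLeast U R m
  AtLeast-preimage (zs , (ws , ds) , m≤) with preimages ws ds
  ... | xs , distinct , ss = xs , distinct , ≤-trans m≤ (≤-reflexive (sym (Pointwise-length ss)))

all-or-any : ∀ {k} {A B : Fin k → Set} → (∀ q → A q ⊎ B q) → (∀ q → A q) ⊎ ∃ B
all-or-any {zero}  _ = inj₁ λ ()
all-or-any {suc k} A⊎B with A⊎B zero | all-or-any (A⊎B ∘ suc)
... | inj₂ b | _            = inj₂ (zero , b)
... | inj₁ _ | inj₂ (q , b) = inj₂ (suc q , b)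
... | inj₁ a | inj₁ as      = inj₁ (∀-cons a as)

inhabited? : ∀ k → Dec (Fin k)
inhabited? zero    = no λ ()
inhabited? (suc k) = yes zero

prodAt-map : ∀ {I : Set} (f : I → ℕ → ℕ) (is : List I) n →
             prodAt (map f is) n ≡ product (map (λ i → f i n) is)
prodAt-map f []       n = refl
prodAt-map f (i ∷ is) n = cong (f i n *_) (prodAt-map f is n)

bounded-product-over-Fin : ∀ {𝓕} → ProductBounded 𝓕 →
  ∀ {k} (f : Fin k → ℕ → ℕ) → (∀ q → 𝓕 (f q)) → Fin k →
  ∃ λ h → 𝓕 h × (∀ n → 1 ≤ n → product (map (λ q → f q n) (allFin k)) ≤ h n)
bounded-product-over-Fin PB {suc k} f f∈𝓕 _
  with PB (f zero) (map f (tabulate suc)) (f∈𝓕 zero) (All.map⁺ (All.universal f∈𝓕 _))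
... | h , h∈𝓕 , ≤h = h , h∈𝓕 , λ n n≥1 →
  ≤-trans (≤-reflexive (sym (prodAt-map f (allFin (suc k)) n))) (≤h n n≥1)

dichotomy-of-empty-levels : ∀ {𝓕 g} (P : FinPoset) (X : 𝒞 P → Set) →
  Dichotomy 𝓕 g D₂ (λ _ → ⊥) → (∀ n → 1 ≤ n → CardLe P X n 0) → Dichotomy 𝓕 g P X
dichotomy-of-empty-levels P X (inj₁ (f , f∈𝓕 , _)) empty =
  inj₁ (f , f∈𝓕 , λ n n≥1 → AtMost-≤ z≤n (empty n n≥1))
dichotomy-of-empty-levels P X (inj₂ large) _ =
  inj₂ λ n n≥1 → AtLeast-of-empty (large n n≥1)

SameCol-isDecEquivalence : (Q : FinPoset) {n : ℕ} → IsDecEquivalence (SameCol Q {n})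
SameCol-isDecEquivalence Q = record
  { isEquivalence = record
    { refl  = λ _ _ _ → refl
    ; sym   = λ e i j i<j → sym (e i j i<j)
    ; trans = λ e e′ i j i<j → trans (e i j i<j) (e′ i j i<j)
    }
  ; _≟_ = λ χ ψ → all? λ i → all? λ j → (i <? j) →-dec (χ i j ≟ ψ i j)
  }

indicator : ∀ {k} → Fin k → Fin k → Fin 2
indicator q a = if does (a ≟ q) then zero else suc zero

indicator-separates : ∀ {k} (a b : Fin k) → indicator a a ≡ indicator a b → a ≡ b
indicator-separates a b eq with a ≟ a | b ≟ a
... | no a≢a | _       = contradiction refl a≢a
... | yes _  | yes b≡a = sym b≡a
... | yes _  | no _    = contradiction eq λ ()

colourClass : (P : FinPoset) {n : ℕ} → Fin (size P) → Colouring P n → Colouring D₂ n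
colourClass P q χ i j = indicator q (χ i j)

module ColourClasses (P : FinPoset) (X : 𝒞 P → Set) where

  classIdeal : Fin (size P) → 𝒞 D₂ → Set
  classIdeal q (n , ψ) = Image (λ χ → X (n , χ)) (colourClass P q) (SameCol D₂) ψ

  classIdeal-isIdeal : IsIdeal P X → ∀ q → IsIdeal D₂ (classIdeal q)
  classIdeal-isIdeal X-ideal q _ _ (f , f-mono , ψ≡ψ′∘f) (χ , χ∈X , χ~ψ′) =
    (λ i j → χ (f i) (f j)) ,
    X-ideal _ _ (f , f-mono , λ _ _ _ → IsPartialOrder.refl (isPO P)) χ∈X ,
    λ i j i<j → trans (χ~ψ′ (f i) (f j) (f-mono i j i<j)) (sym (ψ≡ψ′∘f i j i<j))

  CardGe-from-class : ∀ q {n m} → CardGe D₂ (classIdeal q) n m → CardGe P X n m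
  CardGe-from-class q = AtLeast-preimage (colourClass P q)
    (IsDecEquivalence.isEquivalence (SameCol-isDecEquivalence D₂))
    (λ e i j i<j → cong (indicator q) (e i j i<j))

  CardLe-from-classes : ∀ {n} (b : Fin (size P) → ℕ) → (∀ q → CardLe D₂ (classIdeal q) n (b q)) →
                        CardLe P X n (product (map b (allFin (size P))))
  CardLe-from-classes b small =
    AtMost-resp-⇒ same-classes⇒SameCol
      (AtMost-⋂ (λ q → On.isDecEquivalence (colourClass P q) (SameCol-isDecEquivalence D₂))
                (λ q → AtMost-kernel (colourClass P q) (λ χ∈X → _ , χ∈X , λ _ _ _ → refl) (small q))
                (allFin (size P)))
    where
    same-classes⇒SameCol : ∀ {n} {χ ψ : Colouring P n} →
      All (λ q → (SameCol D₂ on colourClass P q) χ ψ) (allFin (size P)) → SameCol P χ ψ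
    same-classes⇒SameCol {χ = χ} {ψ} same i j i<j =
      indicator-separates (χ i j) (ψ i j) (All.lookup same (∈-allFin (χ i j)) i j i<j)

  CardLe-of-colourless : ¬ Fin (size P) → ∀ n → 1 ≤ n → CardLe P X n 0
  CardLe-of-colourless no-colour (suc n) _ []      _ = z≤n
  CardLe-of-colourless no-colour (suc n) _ (χ ∷ _) _ = contradiction (χ zero zero) no-colour

open ColourClasses

corollary2p8 : (𝓕 : Family) (g : ℕ → ℕ) → ProductBounded 𝓕 →
    ((X : 𝒞 D₂ → Set) → IsIdeal D₂ X → Dichotomy 𝓕 g D₂ X) →
    (P : FinPoset) (X : 𝒞 P → Set) → IsIdeal P X → Dichotomy 𝓕 g P X
corollary2p8 𝓕 g PB H P X X-ideal
  with all-or-any (λ q → H (classIdeal P X q) (classIdeal-isIdeal P X X-ideal q))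
... | inj₂ (q , large) = inj₂ λ n n≥1 → CardGe-from-class P X q (large n n≥1)
... | inj₁ small with inhabited? (size P)
...   | no no-colour =
  -- ProductBounded only dominates products of at least one factor.
  dichotomy-of-empty-levels P X (H (λ _ → ⊥) (λ _ _ _ ())) (CardLe-of-colourless P X no-colour)
...   | yes q with bounded-product-over-Fin PB (proj₁ ∘ small) (proj₁ ∘ proj₂ ∘ small) q
...     | h , h∈𝓕 , ≤h = inj₁ (h , h∈𝓕 , λ n n≥1 →
  AtMost-≤ (≤h n n≥1) (CardLe-from-classes P X _ λ q → proj₂ (proj₂ (small q)) n n≥1))
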